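{- Let $s'$ be a prefix of a string $s$, and let $z$ and $z'$ be the numbers of phrases in the LZ-End parsings of $s$ and $s'$, respectively. Then $3z \ge z'$.
   Context: For a string $s$, $s[i..j] = s[i]s[i+1]\cdots s[j]$. The LZ-End parsing of $s$ is the decomposition $s = f_1 f_2 \cdots f_z$ built greedily from left to right: if a prefix $s[1..k] = f_1 f_2\cdots f_{i-1}$ has already been parsed, then $f_i[1..|f_i|-1]$ is the longest prefix of $s[k+1..|s|-1]$ that is a suffix of some string $f_1 f_2 \cdots f_j$ with $j < i$ (the empty string counts as such a suffix), and $f_i$ is this prefix extended by the next letter of $s$. The substrings $f_i$ are called phrases, and $z$ is the number of phrases. -}

module Defs where

open import Data.Nat using (ℕ; _≤_)
open import Data.List using (List; []; _∷_; _++_; [_]; length; take; concat)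
open import Data.Product using (∃; ∃-syntax; _×_)
open import Relation.Binary.PropositionalEquality using (_≡_)

-- u is a suffix of f_1 f_2 ... f_j for some j ≤ i-1, where ps = f_1 ... f_{i-1}
-- are the phrases produced so far (j = 0 gives the empty string).
Source : {A : Set} → List (List A) → List A → Set
Source ps u = ∃[ j ] (j ≤ length ps × ∃[ w ] (w ++ u ≡ concat (take j ps)))

-- LZEndFrom ps r qs : given the phrases ps already produced, the greedy
-- LZ-End parsing of the remaining (unparsed) suffix r is the list qs.
data LZEndFrom {A : Set} (ps : List (List A)) : List A → List (List A) → Set where
  done : LZEndFrom ps [] []
  step : ∀ {r qs} (u : List A) (c : A) (rest : List A)
       → r ≡ u ++ c ∷ rest
       → Source ps u
       → (∀ (u' : List A) (c' : A) (rest' : List A)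
            → r ≡ u' ++ c' ∷ rest' → Source ps u' → length u' ≤ length u)
       → LZEndFrom (ps ++ [ u ++ [ c ] ]) rest qs
       → LZEndFrom ps r ((u ++ [ c ]) ∷ qs)

LZEnd : {A : Set} → List A → List (List A) → Set
LZEnd s fs = LZEndFrom [] s fs

-- Every LZ-End phrase is a source (a suffix of the text up to an earlier phrase
-- boundary) followed by one letter. Hence, if ps are the phrases already produced,
-- the greedy parse of any factor r of f₁⋯fₘ has at most m + 1 phrases: by induction
-- on m, either r lies in f₁⋯fₘ₋₁, or its part up to the boundary after fₘ₋₁ is a
-- source, so the first phrase of r reaches past that boundary and leaves a factor
-- of fₘ. Such a factor either lies in the body of fₘ, which lies in some f₁⋯fⱼ with
-- j < m, or it is a source plus one letter, that is, a single phrase.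
-- The parses of s and of its prefix s′ coincide up to the phrase fₖ₊₁ of s in which
-- s′ ends, and the remainder of s′ there is a factor of f₁⋯fₖ; so s′ has at most
-- k + (k + 1) ≤ 2z phrases.
module Submission where

open import Defs
open import Data.Nat using (ℕ; zero; suc; _≤_; _<_; _+_; _*_; z≤n; s≤s; s≤s⁻¹)
open import Data.Nat.Properties
  using (≤-refl; ≤-trans; ≤-reflexive; ≤-antisym; <⇒≤; m≤n⇒m≤1+n; m≤n+m; m≤n⇒m<n∨m≡n;
         m+1+n≰m; +-comm; +-monoʳ-≤; suc-injective)
open import Data.Nat.Tactic.RingSolver using (solve-∀)
open import Data.List using (List; []; _∷_; _++_; [_]; length; take; concat)
open import Data.List.Properties
  using (++-assoc; ++-identityʳ; ++-conicalˡ; ++-conicalʳ; length-++; ∷-injective; ∷-injectiveʳ)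
open import Data.Product using (∃-syntax; _×_; _,_)
open import Data.Sum using (_⊎_; inj₁; inj₂)
open import Data.Empty using (⊥-elim)
open import Relation.Binary.PropositionalEquality
  using (_≡_; _≢_; refl; sym; trans; cong; subst; module ≡-Reasoning)

length-∷ʳ : ∀ {B : Set} (xs : List B) x → length (xs ++ [ x ]) ≡ suc (length xs)
length-∷ʳ []       x = refl
length-∷ʳ (y ∷ xs) x = cong suc (length-∷ʳ xs x)

module _ {A : Set} where

  private variable
    c c′ : A
    r s t u v xs ys vs : List A

  []≢++∷ : ∀ (u : List A) c vs → [] ≢ u ++ c ∷ vs
  []≢++∷ u c vs eq with () ← ++-conicalʳ u (c ∷ vs) (sym eq)

  ++-≡-++ : ∀ (xs ys us vs : List A) → xs ++ ys ≡ us ++ vs →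
            (∃[ m ] (us ≡ xs ++ m × ys ≡ m ++ vs)) ⊎ (∃[ m ] (xs ≡ us ++ m × vs ≡ m ++ ys))
  ++-≡-++ []       ys us       vs eq = inj₁ (us , refl , eq)
  ++-≡-++ (x ∷ xs) ys []       vs eq = inj₂ (x ∷ xs , refl , sym eq)
  ++-≡-++ (x ∷ xs) ys (y ∷ us) vs eq with refl , eq′ ← ∷-injective eq
    with ++-≡-++ xs ys us vs eq′
  ... | inj₁ (m , us≡ , ys≡) = inj₁ (m , cong (x ∷_) us≡ , ys≡)
  ... | inj₂ (m , xs≡ , vs≡) = inj₂ (m , cong (x ∷_) xs≡ , vs≡)

  ++-≡-++-length : ∀ (xs ys us vs : List A) → xs ++ ys ≡ us ++ vs → length xs ≡ length us →
                   xs ≡ us × ys ≡ vs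
  ++-≡-++-length []       ys []       vs eq _ = refl , eq
  ++-≡-++-length (x ∷ xs) ys (y ∷ us) vs eq len with refl , eq′ ← ∷-injective eq
    with refl , ys≡ ← ++-≡-++-length xs ys us vs eq′ (suc-injective len) = refl , ys≡

  Prefix Suffix Factor : List A → List A → Set
  Prefix u xs = ∃[ v ] (u ++ v ≡ xs)
  Suffix u xs = ∃[ w ] (w ++ u ≡ xs)
  Factor u xs = ∃[ w ] ∃[ v ] (w ++ u ++ v ≡ xs)

  ++-≡-++-≤ : ∀ (xs ys us vs : List A) → xs ++ ys ≡ us ++ vs → length xs ≤ length us →
              Suffix vs ys
  ++-≡-++-≤ xs ys us vs eq le with ++-≡-++ xs ys us vs eq
  ... | inj₁ (m , _ , ys≡)     = m , sym ys≡
  ... | inj₂ ([] , _ , vs≡)    = [] , vs≡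
  ... | inj₂ (y ∷ m , xs≡ , _) =
    ⊥-elim (m+1+n≰m (length us) (subst (_≤ length us) (trans (cong length xs≡) (length-++ us)) le))

  ++-≡-++∷ : ∀ (xs ys us : List A) c vs → xs ++ ys ≡ us ++ c ∷ vs →
             Prefix xs us ⊎ ∃[ k ] (xs ≡ us ++ c ∷ k)
  ++-≡-++∷ xs ys us c vs eq with ++-≡-++ xs ys us (c ∷ vs) eq
  ... | inj₁ (m , us≡ , _)  = inj₁ (m , sym us≡)
  ... | inj₂ ([] , xs≡ , _) = inj₁ ([] , trans (++-identityʳ xs) (trans xs≡ (++-identityʳ us)))
  ... | inj₂ (y ∷ k , xs≡ , c∷vs≡) with refl , _ ← ∷-injective c∷vs≡ = inj₂ (k , xs≡)

  suffix-trans : Suffix u v → Suffix v xs → Suffix u xs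
  suffix-trans {u} (w , refl) (w′ , refl) = w′ ++ w , ++-assoc w′ w u

  suffix-∷⁻ : Suffix (c ∷ vs) (c′ ∷ ys) → Suffix vs ys
  suffix-∷⁻ ([] , eq)         = [] , ∷-injectiveʳ eq
  suffix-∷⁻ {c} {vs} (_ ∷ w , eq) = w ++ [ c ] , trans (++-assoc w [ c ] vs) (∷-injectiveʳ eq)

  suffix-[] : Suffix vs [] → vs ≡ []
  suffix-[] {vs} (w , eq) = ++-conicalʳ w vs eq

  prefix⇒factor : Prefix u xs → Factor u xs
  prefix⇒factor (v , eq) = [] , v , eq

  suffix⇒factor : Suffix u xs → Factor u xs
  suffix⇒factor {u} (w , eq) = w , [] , trans (cong (w ++_) (++-identityʳ u)) eq

  factor-trans : Factor r s → Factor s xs → Factor r xs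
  factor-trans {r} (w , v , refl) (w′ , v′ , refl) = w′ ++ w , v ++ v′ , reassoc
    where
      open ≡-Reasoning
      reassoc : (w′ ++ w) ++ r ++ v ++ v′ ≡ w′ ++ (w ++ r ++ v) ++ v′
      reassoc = begin
        (w′ ++ w) ++ r ++ v ++ v′     ≡⟨ ++-assoc w′ w _ ⟩
        w′ ++ w ++ r ++ v ++ v′       ≡⟨ cong (λ y → w′ ++ w ++ y) (++-assoc r v v′) ⟨
        w′ ++ w ++ (r ++ v) ++ v′     ≡⟨ cong (w′ ++_) (++-assoc w (r ++ v) v′) ⟨
        w′ ++ (w ++ r ++ v) ++ v′     ∎

  []-factor : Factor [] xs
  []-factor {xs} = xs , [] , ++-identityʳ xs

  factor-[] : Factor r [] → r ≡ []
  factor-[] {r} (w , v , eq) = ++-conicalˡ r v (++-conicalʳ w _ eq)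

  factor-[_] : ∀ c {c′ vs} → Factor (c′ ∷ vs) [ c ] → c′ ≡ c × vs ≡ []
  factor-[ c ] {c′} {vs} ([] , v , eq) with c′≡c , vs++v≡[] ← ∷-injective eq =
    c′≡c , ++-conicalˡ vs v vs++v≡[]
  factor-[ c ] {c′} {vs} (_ ∷ w , v , eq) = ⊥-elim ([]≢++∷ w c′ (vs ++ v) (sym (∷-injectiveʳ eq)))

  -- a may be [], so factors of ys fall under the second case.
  factor-++ : Factor r (xs ++ ys) →
              Factor r xs ⊎ ∃[ a ] ∃[ c ] ∃[ b ] (r ≡ a ++ c ∷ b × Suffix a xs × Factor (c ∷ b) ys)
  factor-++ {r} {xs} {ys} (w , v , eq) with ++-≡-++ w (r ++ v) xs ys eq
  factor-++ {[]}    {xs} (w , v , eq) | inj₂ _                = inj₁ []-factor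
  factor-++ {c ∷ b} {xs} (w , v , eq) | inj₂ (m , _ , ys≡)    =
    inj₂ ([] , c , b , refl , (xs , ++-identityʳ xs) , (m , v , sym ys≡))
  factor-++ {r}          (w , v , eq) | inj₁ (m , xs≡ , r++v≡) with ++-≡-++ r v m _ r++v≡
  ... | inj₁ (k , m≡ , _)          = inj₁ (w , k , sym (trans xs≡ (cong (w ++_) m≡)))
  ... | inj₂ ([] , r≡ , _)         =
    inj₁ (w , [] , trans (cong (w ++_) (trans (++-identityʳ r) (trans r≡ (++-identityʳ m))))
                         (sym xs≡))
  ... | inj₂ (c ∷ b , r≡ , ys≡)    = inj₂ (m , c , b , r≡ , (w , sym xs≡) , ([] , v , sym ys≡))

  factor-∷ʳ : Factor r (xs ++ [ c ]) → Factor r xs ⊎ ∃[ t ] (r ≡ t ++ [ c ] × Suffix t xs)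
  factor-∷ʳ {c = c} fac with factor-++ fac
  ... | inj₁ fac′ = inj₁ fac′
  ... | inj₂ (a , _ , _ , r≡ , suf , fac′) with refl , refl ← factor-[ c ] fac′ =
    inj₂ (a , r≡ , suf)

  Text : List (List A) → ℕ → List A
  Text ps j = concat (take j ps)

  text-prefix : ∀ ps {j m} → j ≤ m → Prefix (Text ps j) (Text ps m)
  text-prefix ps       {zero}  {m}     _         = Text ps m , refl
  text-prefix []       {suc j} {suc m} _         = [] , refl
  text-prefix (p ∷ ps) {suc j} {suc m} (s≤s j≤m) with y , eq ← text-prefix ps j≤m =
    y , trans (++-assoc p _ y) (cong (p ++_) eq)

  text-∷ʳ : ∀ ps (x : List A) {j} → j ≤ length ps → Text (ps ++ [ x ]) j ≡ Text ps j
  text-∷ʳ ps       x {zero}  _         = refl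
  text-∷ʳ (p ∷ ps) x {suc j} (s≤s j≤n) = cong (p ++_) (text-∷ʳ ps x j≤n)

  text-∷ʳ-length : ∀ ps (x : List A) →
                   Text (ps ++ [ x ]) (suc (length ps)) ≡ Text ps (length ps) ++ x
  text-∷ʳ-length []       x = ++-identityʳ x
  text-∷ʳ-length (p ∷ ps) x = trans (cong (p ++_) (text-∷ʳ-length ps x)) (sym (++-assoc p _ x))

  -- Source ps u is, definitionally, BoundarySuffix ps (length ps) u.
  BoundarySuffix : List (List A) → ℕ → List A → Set
  BoundarySuffix ps m u = ∃[ j ] (j ≤ m × Suffix u (Text ps j))

  boundarySuffix-∷ʳ : ∀ {ps m} (x : List A) → m ≤ length ps →
                      BoundarySuffix ps m u → BoundarySuffix (ps ++ [ x ]) m u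
  boundarySuffix-∷ʳ {ps = ps} x m≤n (j , j≤m , w , eq) =
    j , j≤m , w , trans eq (sym (text-∷ʳ ps x (≤-trans j≤m m≤n)))

  boundarySuffix⇒factor : ∀ {ps : List (List A)} {m} →
                          BoundarySuffix ps m u → Factor r u → Factor r (Text ps m)
  boundarySuffix⇒factor {ps = ps} (j , j≤m , suf) fac =
    factor-trans fac (factor-trans (suffix⇒factor suf) (prefix⇒factor (text-prefix ps j≤m)))

  Sourced : List (List A) → Set
  Sourced ps = ∀ m → m < length ps →
    ∃[ u ] ∃[ c ] (Text ps (suc m) ≡ Text ps m ++ u ++ [ c ] × BoundarySuffix ps m u)

  sourced-[] : Sourced []
  sourced-[] m ()

  sourced-∷ʳ : ∀ {ps : List (List A)} c → Sourced ps → Source ps u →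
               Sourced (ps ++ [ u ++ [ c ] ])
  sourced-∷ʳ {u = u} {ps = ps} c sourced src m m<
    with m≤n⇒m<n∨m≡n (s≤s⁻¹ (subst (m <_) (length-∷ʳ ps (u ++ [ c ])) m<))
  ... | inj₁ m<n with u′ , c′ , text≡ , bs ← sourced m m<n =
    u′ , c′ ,
    trans (text-∷ʳ ps _ m<n)
          (trans text≡ (cong (_++ u′ ++ [ c′ ]) (sym (text-∷ʳ ps _ (<⇒≤ m<n))))) ,
    boundarySuffix-∷ʳ _ (<⇒≤ m<n) bs
  ... | inj₂ refl =
    u , c ,
    trans (text-∷ʳ-length ps _) (cong (_++ u ++ [ c ]) (sym (text-∷ʳ ps _ ≤-refl))) ,
    boundarySuffix-∷ʳ _ ≤-refl src

  parse-[] : ∀ {ps qs : List (List A)} → LZEndFrom ps [] qs → qs ≡ []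
  parse-[] done                      = refl
  parse-[] (step u c rest eq _ _ _) = ⊥-elim ([]≢++∷ u c rest eq)

  single-phrase : ∀ {ps qs : List (List A)} → Source ps t → r ≡ t ++ [ c ] →
                  LZEndFrom ps r qs → length qs ≤ 1
  single-phrase {t} {c = c} src r≡ done = ⊥-elim ([]≢++∷ t c [] r≡)
  single-phrase {t} {c = c} src r≡ (step u c₁ rest eq _ longest tail)
    with refl ← suffix-[] (suffix-∷⁻ (++-≡-++-≤ t [ c ] u (c₁ ∷ rest) (trans (sym r≡) eq)
                                                   (longest t c [] r≡ src)))
    = s≤s (≤-reflexive (cong length (parse-[] tail)))

  FactorBound : ℕ → Set
  FactorBound m = ∀ {ps : List (List A)} {r qs} → Sourced ps → m ≤ length ps →
                  Factor r (Text ps m) → LZEndFrom ps r qs → length qs ≤ suc m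

  phrase-factor-bound : ∀ {m} → FactorBound m → ∀ {ps qs : List (List A)} c →
                        Sourced ps → m ≤ length ps → BoundarySuffix ps m u →
                        Factor r (u ++ [ c ]) → LZEndFrom ps r qs → length qs ≤ suc m
  phrase-factor-bound bound c sourced m≤n bs@(j , j≤m , suf) fac parse with factor-∷ʳ fac
  ... | inj₁ fac′             = bound sourced m≤n (boundarySuffix⇒factor bs fac′) parse
  ... | inj₂ (t , r≡ , suf′) =
    ≤-trans (single-phrase (j , ≤-trans j≤m m≤n , suffix-trans suf′ suf) r≡ parse) (s≤s z≤n)

  factor-parse-bound : ∀ m → FactorBound m
  factor-parse-bound m       _ _ _ done = z≤n
  factor-parse-bound zero    _ _ fac (step u c rest eq _ _ _) =
    ⊥-elim ([]≢++∷ u c rest (trans (sym (factor-[] fac)) eq))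
  factor-parse-bound (suc m) {ps} sourced m<n fac parse@(step u c rest eq src longest tail)
    with u₀ , c₀ , text≡ , bs ← sourced m m<n
    with factor-++ (subst (Factor _) text≡ fac)
  ... | inj₁ fac′ = m≤n⇒m≤1+n (factor-parse-bound m sourced (<⇒≤ m<n) fac′ parse)
  ... | inj₂ (a , c′ , b , r≡ , suf , fac′) =
    s≤s (phrase-factor-bound (factor-parse-bound m) c₀ (sourced-∷ʳ c sourced src) m≤n′
           (boundarySuffix-∷ʳ _ (<⇒≤ m<n) bs) rest-factor tail)
    where
      m≤n′ : m ≤ length (ps ++ [ u ++ [ c ] ])
      m≤n′ = subst (m ≤_) (sym (length-∷ʳ ps _)) (m≤n⇒m≤1+n (<⇒≤ m<n))
      -- a ends at a phrase boundary, so the first phrase of r reaches past it.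
      rest-suffix : Suffix rest b
      rest-suffix = suffix-∷⁻ (++-≡-++-≤ a (c′ ∷ b) u (c ∷ rest) (trans (sym r≡) eq)
                                         (longest a c′ b r≡ (m , <⇒≤ m<n , suf)))
      rest-factor : Factor rest (u₀ ++ [ c₀ ])
      rest-factor = factor-trans (suffix⇒factor (suffix-trans rest-suffix ([ c′ ] , refl))) fac′

  prefix-parse-bound : ∀ {ps : List (List A)} {r′ qs qs′} t → Sourced ps → r′ ++ t ≡ r →
                       LZEndFrom ps r qs → LZEndFrom ps r′ qs′ →
                       length qs′ ≤ length ps + 2 * length qs
  prefix-parse-bound t _ _ _ done = z≤n
  prefix-parse-bound t _ e done (step u′ c′ rest′ refl _ _ _) =
    ⊥-elim ([]≢++∷ u′ c′ rest′ (sym (++-conicalˡ _ t e)))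
  prefix-parse-bound {ps = ps} t sourced e (step {qs = qs} u c rest refl src longest tail)
                     parse′@(step {qs = qs′₀} u′ c′ rest′ refl src′ longest′ tail′)
    with ++-≡-++∷ (u′ ++ c′ ∷ rest′) t u c rest e
  ... | inj₁ r′-prefix =
    ≤-trans (factor-parse-bound (length ps) sourced ≤-refl
               (boundarySuffix⇒factor src (prefix⇒factor r′-prefix)) parse′)
            (≤-trans (≤-reflexive (+-comm 1 (length ps))) (+-monoʳ-≤ (length ps) (s≤s z≤n)))
  ... | inj₂ (k , r′≡)
    with r≡ ← trans (sym e) (++-assoc u′ (c′ ∷ rest′) t)
    -- Each first phrase body is a source candidate for the other string.
    with refl , e′ ← ++-≡-++-length u′ _ u _ (sym r≡)
                       (≤-antisym (longest u′ c′ (rest′ ++ t) r≡ src′) (longest′ u c k r′≡ src))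
    with refl , rest′++t≡rest ← ∷-injective e′ =
    subst (suc (length qs′₀) ≤_) (shift (length ps) (length qs))
      (s≤s (subst (λ n → _ ≤ n + 2 * length qs) (length-∷ʳ ps _)
                  (prefix-parse-bound t (sourced-∷ʳ c sourced src) rest′++t≡rest tail tail′)))
    where
      shift : ∀ p q → suc (suc p + 2 * q) ≡ p + 2 * suc q
      shift = solve-∀

lemma4 : {A : Set} (s s' : List A) → ∃[ t ] (s' ++ t ≡ s)
       → (fs fs' : List (List A)) → LZEnd s fs → LZEnd s' fs'
       → length fs' ≤ 3 * length fs
lemma4 s s' (t , e) fs fs' parse parse' =
  ≤-trans (prefix-parse-bound t sourced-[] e parse parse') (m≤n+m (2 * length fs) (length fs))
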